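{- Let $P$ be a $\Sigma$-pattern with first symbol in $\Sigma$ and exactly one gap such that $\mathrm{T}(P)$ is completely additive, and suppose $|P|$ is not a prime power. Then $\mathrm{T}(P)$ is the constant zero sequence.
   Context: $\Sigma$ is a finite cyclic group; gaps are bijections of $\Sigma$, $?$ the identity. For words $x,y$ over $\Sigma\cup\mathrm{S}_\Sigma$: $(a\,x)\langle y\rangle=a\,x\langle y\rangle$, $(f\,x)\langle b\,y\rangle=f(b)\,x\langle y\rangle$, $(f\,x)\langle g\,y\rangle=(f\circ g)\,x\langle y\rangle$. For $P$ with first symbol in $\Sigma$: $T_0=?^\omega$, $T_{i+1}=P^\omega\langle T_i\rangle$, $\mathrm{T}(P)=\lim T_i$, indexed by positive integers. Completely additive: $\sigma(1)=0$, $\sigma(nm)=\sigma(n)+\sigma(m)$. -}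

module Defs where

open import Data.Nat using (ℕ; zero; suc; _+_; _*_; _^_; _≤_; pred)
open import Data.Nat.DivMod using (_mod_; _%_)
open import Data.Nat.Primality using (Prime)
open import Data.Fin using (Fin; toℕ)
open import Data.Fin.Permutation using (Permutation′; _∘ₚ_; _⟨$⟩ʳ_)
import Data.Fin.Permutation as Perm
open import Data.List using (List; _∷_; []; length; lookup)
open import Data.Product using (∃; ∃-syntax; _×_; _,_)
open import Relation.Binary.PropositionalEquality using (_≡_)
open import Relation.Nullary using (¬_)

-- The finite cyclic group Σ = ℤ/(suc k)ℤ, carried by Fin (suc k).
_⊕_ : ∀ {k} → Fin (suc k) → Fin (suc k) → Fin (suc k)
_⊕_ {k} a b = (toℕ a + toℕ b) mod (suc k)

data Sym (k : ℕ) : Set where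
  lit : Fin (suc k) → Sym k
  gap : Permutation′ (suc k) → Sym k

idGap : ∀ {k} → Sym k
idGap = gap Perm.id

isGap : ∀ {k} → Sym k → ℕ
isGap (lit _) = 0
isGap (gap _) = 1

-- Infinite words are functions ℕ → Sym k (index 0 = first position).
-- number of gaps among positions 0 .. n-1 of x
gapsBefore : ∀ {k} → (ℕ → Sym k) → ℕ → ℕ
gapsBefore x zero = 0
gapsBefore x (suc n) = gapsBefore x n + isGap (x n)

gapCount : ∀ {k} → List (Sym k) → ℕ
gapCount [] = 0
gapCount (s ∷ w) = isGap s + gapCount w

plug : ∀ {k} → Permutation′ (suc k) → Sym k → Sym k
plug f (lit b) = lit (f ⟨$⟩ʳ b)
plug f (gap g) = gap (g ∘ₚ f)   -- = f ∘ g  (g ∘ₚ f applies g first, then f)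

-- x⟨y⟩ : the j-th gap of x (0-based) is filled with the j-th symbol of y
fill : ∀ {k} → (ℕ → Sym k) → (ℕ → Sym k) → ℕ → Sym k
fill x y n with x n
... | lit a = lit a
... | gap f = plug f (y (gapsBefore x n))

-- P^ω for the pattern P = s ∷ rest
omega : ∀ {k} → Sym k → List (Sym k) → ℕ → Sym k
omega s rest n = lookup (s ∷ rest) (n mod suc (length rest))

Tseq : ∀ {k} → Sym k → List (Sym k) → ℕ → ℕ → Sym k
Tseq s rest zero = λ _ → idGap
Tseq s rest (suc i) = fill (omega s rest) (Tseq s rest i)

IsLimit : ∀ {k} → (ℕ → ℕ → Sym k) → (ℕ → Fin (suc k)) → Set
IsLimit T t = ∀ n → ∃[ i ] (∀ j → i ≤ j → T j n ≡ lit (t n))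

-- completely additive, with t n being the value at the positive integer n+1
CompletelyAdditive : ∀ {k} → (ℕ → Fin (suc k)) → Set
CompletelyAdditive t =
  (t 0 ≡ Fin.zero) × (∀ n m → t (pred (suc n * suc m)) ≡ t n ⊕ t m)

IsPrimePower : ℕ → Set
IsPrimePower n = ∃[ p ] ∃[ e ] (Prime p × n ≡ p ^ suc e)

-- Write P = lit a ∷ rest, L = |P|, and read the sequence t as a function
-- on the positive integers, t at N = t (N - 1).  Every letter of P is
-- placed by T₁ and never overwritten, so t at N is the letter of P at
-- position (N - 1) mod L whenever that symbol is a letter.  The single gap
-- of P either is or is not the last symbol of P:
--
--  * last symbol a letter: t at (N·L) = t at L for all N, and cancelling
--    t at L in t at (N·L) = t at N ⊕ t at L gives t at N = 0 directly;
--  * last symbol the gap: t is L-periodic off the multiples of L.  Since L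
--    is not a prime power, L = u·v with u, v ≥ 2 coprime.  Comparing
--    t at (u·(1 + j·v)) with t at u shows that t vanishes on 1 + vℕ, and
--    likewise on 1 + uℕ; by the Chinese remainder theorem every N not
--    divisible by L is congruent to a product of two such numbers, so t
--    vanishes off the multiples of L, t at L = t at u ⊕ t at v = 0, and
--    induction on N = q·L finishes the argument.
module Submission where

open import Defs
open import Data.Nat
  using (ℕ; zero; suc; _+_; _*_; _^_; _≤_; _<_; pred; NonZero; NonTrivial; s≤s; z≤n;
         >-nonZero; nonTrivial⇒n>1; n>1⇒nonTrivial)
open import Data.Nat.Properties
  using (suc-injective; +-cancelˡ-≡; +-identityʳ; +-comm; *-comm; *-assoc; *-identityˡ; *-zeroʳ; *-identityʳ;
         ≤-refl; ≤-trans; n≤1+n; m≤m*n; m<m*n; m^n≢0; ≤⇒≯)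
open import Data.Nat.DivMod
  using (_%_; _/_; _mod_; m≡m%n+[m/n]*n; m<n⇒m%n≡m; m≤n⇒m%n≡m; m*n%n≡0; [m+kn]%n≡m%n; m%n<n)
open import Data.Nat.Divisibility
  using (_∣_; divides; _∣?_; ∣-trans; ∣1⇒≡1; ∣⇒≤; _∣0; quotient≢0; quotient-<; m∣m*n)
open import Data.Nat.Coprimality using (Coprime; coprime-divisor; coprime-Bézout)
  renaming (sym to ⊥-sym)
open import Data.Nat.GCD using (module Bézout)
open import Data.Nat.Primality using (Prime; prime⇒irreducible; prime⇒nonZero; prime⇒nonTrivial)
open import Data.Nat.Primality.Factorisation using (factorise)
open import Data.Nat.Induction using (<-rec)
open import Data.Nat.Tactic.RingSolver using (solve)
open import Data.Fin using (Fin; toℕ; fromℕ)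
open import Data.Fin.Properties using (toℕ-fromℕ<; toℕ-fromℕ; toℕ-injective; toℕ<n)
open import Data.List using (List; _∷_; []; length; lookup)
import Data.List.Relation.Unary.All as All
open import Data.Product using (∃-syntax; _×_; _,_; proj₂)
open import Data.Sum using (inj₁; inj₂)
open import Function using (_∘_)
open import Relation.Binary.PropositionalEquality
  using (_≡_; _≢_; refl; sym; trans; cong; cong₂; subst; module ≡-Reasoning)
open import Relation.Nullary using (¬_; yes; no; contradiction)

toℕ-mod : ∀ n L .{{_ : NonZero L}} → toℕ (n mod L) ≡ n % L
toℕ-mod n L = toℕ-fromℕ< (m%n<n n L)

⊕-cancelʳ : ∀ {k} (x y : Fin (suc k)) → x ⊕ y ≡ y → x ≡ Fin.zero
⊕-cancelʳ {k} x y x⊕y≡y = toℕ-injective (begin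
    X           ≡⟨ m<n⇒m%n≡m (toℕ<n x) ⟨
    X % L       ≡⟨ cong (_% L) X≡q*L ⟩
    (q * L) % L ≡⟨ m*n%n≡0 q L ⟩
    0           ∎)
  where
    open ≡-Reasoning
    L = suc k
    X = toℕ x
    Y = toℕ y
    q = (X + Y) / L
    X+Y≡Y+q*L : X + Y ≡ Y + q * L
    X+Y≡Y+q*L = begin
      X + Y               ≡⟨ m≡m%n+[m/n]*n (X + Y) L ⟩
      (X + Y) % L + q * L ≡⟨ cong (_+ q * L) (trans (sym (toℕ-mod (X + Y) L)) (cong toℕ x⊕y≡y)) ⟩
      Y + q * L           ∎
    X≡q*L : X ≡ q * L
    X≡q*L = +-cancelˡ-≡ Y X (q * L) (trans (+-comm Y X) X+Y≡Y+q*L)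

-- A factorisation L = u·v into coprime factors u, v ≥ 2, recorded through
-- a Bézout identity x·u = 1 + y·v (the only consequence of coprimality used).
record CoprimeSplit (L : ℕ) : Set where
  field
    u v x y : ℕ
    u*v≡L   : u * v ≡ L
    2≤u     : 2 ≤ u
    2≤v     : 2 ≤ v
    bézout  : x * u ≡ 1 + y * v

prime-divisor : ∀ L → 2 ≤ L → ∃[ p ] (Prime p × p ∣ L)
prime-divisor (suc zero) (s≤s ())
prime-divisor L@(suc (suc _)) _ with factorise L
... | record { factors = [] ; isFactorisation = L≡1 } = contradiction L≡1 λ ()
... | record { factors = p ∷ ps ; isFactorisation = L≡p*ps ; factorsPrime = p-prime All.∷ _ } =
  p , p-prime , subst (p ∣_) (sym L≡p*ps) (m∣m*n _)

p-part : ∀ p .{{_ : NonTrivial p}} n .{{_ : NonZero n}} → ∃[ e ] ∃[ m ] (n ≡ p ^ e * m × ¬ p ∣ m)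
p-part p = <-rec (λ n → .{{NonZero n}} → ∃[ e ] ∃[ m ] (n ≡ p ^ e * m × ¬ p ∣ m)) step
  where
    step : ∀ n → (∀ {n′} → n′ < n → .{{NonZero n′}} → ∃[ e ] ∃[ m ] (n′ ≡ p ^ e * m × ¬ p ∣ m))
         → .{{NonZero n}} → ∃[ e ] ∃[ m ] (n ≡ p ^ e * m × ¬ p ∣ m)
    step n rec with p ∣? n
    ... | no p∤n = 0 , n , sym (+-identityʳ n) , p∤n
    ... | yes p∣n@(divides q n≡q*p) with rec (quotient-< p∣n) {{quotient≢0 p∣n}}
    ...   | e , m , q≡pᵉm , p∤m = suc e , m , n≡pᵉ⁺¹m , p∤m
      where
        n≡pᵉ⁺¹m : n ≡ p ^ suc e * m
        n≡pᵉ⁺¹m = begin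
          n               ≡⟨ n≡q*p ⟩
          q * p           ≡⟨ cong (_* p) q≡pᵉm ⟩
          p ^ e * m * p   ≡⟨ *-comm (p ^ e * m) p ⟩
          p * (p ^ e * m) ≡⟨ *-assoc p (p ^ e) m ⟨
          p * p ^ e * m   ∎
          where open ≡-Reasoning

coprime-to-prime : ∀ {p m} → Prime p → ¬ p ∣ m → Coprime m p
coprime-to-prime p-prime p∤m (d∣m , d∣p) with prime⇒irreducible p-prime d∣p
... | inj₁ d≡1 = d≡1
... | inj₂ refl = contradiction d∣m p∤m

coprime-to-prime-power : ∀ {p m} → Prime p → ¬ p ∣ m → ∀ e → Coprime m (p ^ e)
coprime-to-prime-power p-prime p∤m zero (_ , d∣1) = ∣1⇒≡1 d∣1
coprime-to-prime-power {p} p-prime p∤m (suc e) (d∣m , d∣p*pᵉ) =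
  coprime-to-prime-power p-prime p∤m e (d∣m , coprime-divisor d⊥p d∣p*pᵉ)
  where
    d⊥p : Coprime _ p
    d⊥p = coprime-to-prime p-prime (λ p∣d → p∤m (∣-trans p∣d d∣m))

coprime-split : ∀ {L} u v → u * v ≡ L → 2 ≤ u → 2 ≤ v → Coprime u v → CoprimeSplit L
coprime-split u v u*v≡L 2≤u 2≤v u⊥v with coprime-Bézout u⊥v
... | Bézout.+- x y 1+yv≡xu = record
  { u = u ; v = v ; x = x ; y = y ; u*v≡L = u*v≡L ; 2≤u = 2≤u ; 2≤v = 2≤v ; bézout = sym 1+yv≡xu }
... | Bézout.-+ x y 1+xu≡yv = record
  { u = v ; v = u ; x = y ; y = x ; u*v≡L = trans (*-comm v u) u*v≡L
  ; 2≤u = 2≤v ; 2≤v = 2≤u ; bézout = sym 1+xu≡yv }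

-- A number L ≥ 2 that is not a prime power splits as (p-part)·(rest).
non-prime-power-split : ∀ L → 2 ≤ L → ¬ IsPrimePower L → CoprimeSplit L
non-prime-power-split L 2≤L not-prime-power with prime-divisor L 2≤L
... | p , p-prime , p∣L with p-part p {{prime⇒nonTrivial p-prime}} L {{L≢0}}
  where
    L≢0 : NonZero L
    L≢0 = >-nonZero (≤-trans (s≤s z≤n) 2≤L)
...   | zero , m , L≡1*m , p∤m = contradiction (subst (p ∣_) (trans L≡1*m (*-identityˡ m)) p∣L) p∤m
...   | suc e , zero , L≡0 , _ = contradiction (subst (2 ≤_) (trans L≡0 (*-zeroʳ (p ^ suc e))) 2≤L) λ ()
...   | suc e , suc zero , L≡pᵉ⁺¹ , _ =
  contradiction (p , e , p-prime , trans L≡pᵉ⁺¹ (*-identityʳ _)) not-prime-power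
...   | suc e , m@(suc (suc _)) , L≡pᵉ⁺¹m , p∤m =
  coprime-split (p ^ suc e) m (sym L≡pᵉ⁺¹m) 2≤pᵉ⁺¹ (s≤s (s≤s z≤n))
    (⊥-sym (coprime-to-prime-power p-prime p∤m (suc e)))
  where
    instance
      p≢0 : NonZero p
      p≢0 = prime⇒nonZero p-prime
      pᵉ≢0 : NonZero (p ^ e)
      pᵉ≢0 = m^n≢0 p e
    2≤pᵉ⁺¹ : 2 ≤ p ^ suc e
    2≤pᵉ⁺¹ = ≤-trans (nonTrivial⇒n>1 p {{prime⇒nonTrivial p-prime}}) (m≤m*n p (p ^ e))

infix 30 _at_
_at_ : {A : Set} → (ℕ → A) → ℕ → A
t at N = t (pred N)

PeriodicOffMultiples : {A : Set} → ℕ → (ℕ → A) → Set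
PeriodicOffMultiples L f = ∀ N q → ¬ L ∣ N → f (N + q * L) ≡ f N

proper-factor-not-multiple : ∀ {L} u v .{{_ : NonZero u}} → u * v ≡ L → 2 ≤ v → ¬ L ∣ u
proper-factor-not-multiple u v u*v≡L 2≤v L∣u =
  ≤⇒≯ (∣⇒≤ L∣u) (subst (u <_) u*v≡L (m<m*n u v 2≤v))

-- If x·u = 1 + y·v with u = 1 + u′, then
-- X = 1 + (n·y·u′)·v ≡ 1 (mod v) and Y = 1 + (n·x)·u ≡ 1 (mod u), and
-- X·Y ≡ 1 + n (mod u·v): indeed (n·y·u′)·v ≡ n and (n·x)·u ≡ n modulo u
-- and v respectively.
crt-product : ∀ n x y u′ v → x * suc u′ ≡ 1 + y * v →
  (1 + n * y * u′ * v) * (1 + n * x * suc u′) ≡ suc n + (n * y + n * n * y * u′ * x) * (suc u′ * v)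
crt-product n x y u′ v xu≡1+yv = begin
  (1 + n * y * u′ * v) * (1 + n * x * suc u′)
    ≡⟨ solve (n ∷ x ∷ y ∷ u′ ∷ v ∷ []) ⟩
  (1 + n * y * u′ * v) + n * (x * suc u′) * (1 + n * y * u′ * v)
    ≡⟨ cong (λ w → (1 + n * y * u′ * v) + n * w * (1 + n * y * u′ * v)) xu≡1+yv ⟩
  (1 + n * y * u′ * v) + n * (1 + y * v) * (1 + n * y * u′ * v)
    ≡⟨ solve (n ∷ y ∷ u′ ∷ v ∷ []) ⟩
  suc n + n * y * (suc u′ * v) + n * n * y * u′ * v * (1 + y * v)
    ≡⟨ cong (λ w → suc n + n * y * (suc u′ * v) + n * n * y * u′ * v * w) xu≡1+yv ⟨
  suc n + n * y * (suc u′ * v) + n * n * y * u′ * v * (x * suc u′)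
    ≡⟨ solve (n ∷ x ∷ y ∷ u′ ∷ v ∷ []) ⟩
  suc n + (n * y + n * n * y * u′ * x) * (suc u′ * v) ∎
  where open ≡-Reasoning

module CompletelyAdditiveSequence {k} (t : ℕ → Fin (suc k)) (additive : CompletelyAdditive t) where

  open ≡-Reasoning

  at-mul : ∀ N M .{{_ : NonZero N}} .{{_ : NonZero M}} → t at (N * M) ≡ t at N ⊕ t at M
  at-mul (suc n) (suc m) = proj₂ additive n m

  absorbed : ∀ N M .{{_ : NonZero N}} .{{_ : NonZero M}} → t at (N * M) ≡ t at M → t at N ≡ Fin.zero
  absorbed N M N*M≈M = ⊕-cancelʳ (t at N) (t at M) (trans (sym (at-mul N M)) N*M≈M)

  vanish-of-constant-on-multiples : ∀ L .{{_ : NonZero L}} →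
    (∀ n → t at (suc n * L) ≡ t at L) → ∀ n → t n ≡ Fin.zero
  vanish-of-constant-on-multiples L constant n = absorbed (suc n) L (constant n)

  module _ {L} (periodic : PeriodicOffMultiples L (t at_)) where

    -- For a proper factorisation L = u·v, t vanishes on 1 + vℕ, since
    -- (1 + j·v)·u = u + j·L has the same value as u.
    one-mod-factor-vanishes : ∀ u v .{{_ : NonZero u}} → u * v ≡ L → 2 ≤ v →
      ∀ j → t at (1 + j * v) ≡ Fin.zero
    one-mod-factor-vanishes u v u*v≡L 2≤v j = absorbed (1 + j * v) u (begin
      t at ((1 + j * v) * u) ≡⟨ cong (t at_) expand ⟩
      t at (u + j * (u * v)) ≡⟨ cong (λ w → t at (u + j * w)) u*v≡L ⟩
      t at (u + j * L)       ≡⟨ periodic u j (proper-factor-not-multiple u v u*v≡L 2≤v) ⟩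
      t at u                 ∎)
      where
        expand : (1 + j * v) * u ≡ u + j * (u * v)
        expand = solve (j ∷ v ∷ u ∷ [])

    -- Off the multiples of L, 1 + n is congruent to a product of numbers
    -- ≡ 1 modulo v and modulo u respectively, so t vanishes there.
    vanish-off-multiples : CoprimeSplit L → ∀ N → ¬ L ∣ N → t at N ≡ Fin.zero
    vanish-off-multiples _ zero L∤0 = contradiction (L ∣0) L∤0
    vanish-off-multiples record { u = u@(suc u′) ; v = v@(suc _) ; x = x ; y = y
                                ; u*v≡L = u*v≡L ; 2≤u = 2≤u ; 2≤v = 2≤v ; bézout = xu≡1+yv }
                         (suc n) L∤N = begin
      t at (suc n)                  ≡⟨ periodic (suc n) c L∤N ⟨
      t at (suc n + c * L)          ≡⟨ cong (t at_) X*Y≡1+n+c*L ⟨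
      t at (X * Y)                  ≡⟨ at-mul X Y ⟩
      t at X ⊕ t at Y               ≡⟨ cong₂ _⊕_ (one-mod-factor-vanishes u v u*v≡L 2≤v (n * y * u′))
                                                 (one-mod-factor-vanishes v u (trans (*-comm v u) u*v≡L) 2≤u (n * x)) ⟩
      Fin.zero ⊕ Fin.zero           ≡⟨⟩
      Fin.zero                      ∎
      where
        X = 1 + n * y * u′ * v
        Y = 1 + n * x * u
        c = n * y + n * n * y * u′ * x
        X*Y≡1+n+c*L : X * Y ≡ suc n + c * L
        X*Y≡1+n+c*L = trans (crt-product n x y u′ v xu≡1+yv) (cong (λ w → suc n + c * w) u*v≡L)

    vanish-at-period : CoprimeSplit L → t at L ≡ Fin.zero
    vanish-at-period split@record { u = u@(suc _) ; v = v@(suc _) ; u*v≡L = u*v≡L ; 2≤u = 2≤u ; 2≤v = 2≤v } =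
      begin
      t at L              ≡⟨ cong (t at_) u*v≡L ⟨
      t at (u * v)        ≡⟨ at-mul u v ⟩
      t at u ⊕ t at v     ≡⟨ cong₂ _⊕_ (off u (proper-factor-not-multiple u v u*v≡L 2≤v))
                                       (off v (proper-factor-not-multiple v u (trans (*-comm v u) u*v≡L) 2≤u)) ⟩
      Fin.zero ⊕ Fin.zero ≡⟨⟩
      Fin.zero            ∎
      where
        off : ∀ N → ¬ L ∣ N → t at N ≡ Fin.zero
        off = vanish-off-multiples split

    vanish-everywhere : 2 ≤ L → CoprimeSplit L → ∀ n → t n ≡ Fin.zero
    vanish-everywhere 2≤L split n = <-rec (λ N → .{{NonZero N}} → t at N ≡ Fin.zero) step (suc n)
      where
        instance
          L-nonTrivial : NonTrivial L
          L-nonTrivial = n>1⇒nonTrivial 2≤L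
          L-nonZero : NonZero L
          L-nonZero = >-nonZero (≤-trans (s≤s z≤n) 2≤L)
        step : ∀ N → (∀ {M} → M < N → .{{NonZero M}} → t at M ≡ Fin.zero) →
               .{{NonZero N}} → t at N ≡ Fin.zero
        step N rec with L ∣? N
        ... | no L∤N = vanish-off-multiples split N L∤N
        ... | yes L∣N@(divides q N≡q*L) = begin
          t at N              ≡⟨ cong (t at_) N≡q*L ⟩
          t at (q * L)        ≡⟨ at-mul q L ⟩
          t at q ⊕ t at L     ≡⟨ cong₂ _⊕_ (rec (quotient-< L∣N)) (vanish-at-period split) ⟩
          Fin.zero ⊕ Fin.zero ≡⟨⟩
          Fin.zero            ∎
          where
            instance
              q≢0 : NonZero q
              q≢0 = quotient≢0 L∣N

open CompletelyAdditiveSequence using (vanish-of-constant-on-multiples; vanish-everywhere)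

fill-at-letter : ∀ {k} (x y : ℕ → Sym k) n {b} → x n ≡ lit b → fill x y n ≡ lit b
fill-at-letter x y n x[n]≡b rewrite x[n]≡b = refl

lit-injective : ∀ {k} {a b : Fin (suc k)} → lit {k} a ≡ lit b → a ≡ b
lit-injective refl = refl

letter-fixed : ∀ {k} s (rest : List (Sym k)) {t} → IsLimit (Tseq s rest) t →
  ∀ n {b} → lookup (s ∷ rest) (n mod suc (length rest)) ≡ lit b → t n ≡ b
letter-fixed s rest limit n P[n]≡b with limit n
... | i , stable = lit-injective (trans (sym (stable (suc i) (n≤1+n i)))
                                        (fill-at-letter (omega s rest) (Tseq s rest i) n P[n]≡b))

mod-periodic : ∀ n q L .{{_ : NonZero L}} → (n + q * L) mod L ≡ n mod L
mod-periodic n q L = toℕ-injective (begin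
  toℕ ((n + q * L) mod L) ≡⟨ toℕ-mod (n + q * L) L ⟩
  (n + q * L) % L         ≡⟨ [m+kn]%n≡m%n n q L ⟩
  n % L                   ≡⟨ toℕ-mod n L ⟨
  toℕ (n mod L)           ∎)
  where open ≡-Reasoning

last-index : ∀ l → l mod suc l ≡ fromℕ l
last-index l = toℕ-injective (trans (toℕ-mod l (suc l)) (trans (m≤n⇒m%n≡m ≤-refl) (sym (toℕ-fromℕ l))))

last-index⇒multiple : ∀ n l → n mod suc l ≡ fromℕ l → suc l ∣ suc n
last-index⇒multiple n l n-at-last = divides (suc (n / L)) (cong suc (begin
  n               ≡⟨ m≡m%n+[m/n]*n n L ⟩
  n % L + n / L * L ≡⟨ cong (_+ n / L * L) n%L≡l ⟩
  l + n / L * L   ∎))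
  where
    open ≡-Reasoning
    L = suc l
    n%L≡l : n % L ≡ l
    n%L≡l = trans (sym (toℕ-mod n L)) (trans (cong toℕ n-at-last) (toℕ-fromℕ l))

no-gaps : ∀ {k} (ws : List (Sym k)) j → gapCount ws ≡ 0 → isGap (lookup ws j) ≡ 0
no-gaps (lit _ ∷ ws) Fin.zero    _    = refl
no-gaps (lit _ ∷ ws) (Fin.suc j) none = no-gaps ws j none
no-gaps (gap _ ∷ ws) _           ()

gap-unique : ∀ {k} (ws : List (Sym k)) i j → gapCount ws ≡ 1 →
  isGap (lookup ws i) ≡ 1 → isGap (lookup ws j) ≡ 1 → i ≡ j
gap-unique (lit _ ∷ ws) Fin.zero    _           _   () _
gap-unique (lit _ ∷ ws) (Fin.suc i) Fin.zero    _   _  ()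
gap-unique (lit _ ∷ ws) (Fin.suc i) (Fin.suc j) one gᵢ gⱼ = cong Fin.suc (gap-unique ws i j one gᵢ gⱼ)
gap-unique (gap _ ∷ ws) Fin.zero    Fin.zero    _   _  _  = refl
gap-unique (gap _ ∷ ws) Fin.zero    (Fin.suc j) one _  gⱼ =
  contradiction (trans (sym (no-gaps ws j (suc-injective one))) gⱼ) λ ()
gap-unique (gap _ ∷ ws) (Fin.suc i) _           one gᵢ _  =
  contradiction (trans (sym (no-gaps ws i (suc-injective one))) gᵢ) λ ()

letter-off-gap : ∀ {k} (ws : List (Sym k)) i j → gapCount ws ≡ 1 →
  isGap (lookup ws i) ≡ 1 → j ≢ i → ∃[ b ] lookup ws j ≡ lit b
letter-off-gap ws i j one gᵢ j≢i with lookup ws j in ws[j]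
... | lit b = b , refl
... | gap _ = contradiction (gap-unique ws j i one (cong isGap ws[j]) gᵢ) j≢i

letter-periodic : ∀ {k} s (rest : List (Sym k)) {t} → IsLimit (Tseq s rest) t →
  ∀ n q {b} → lookup (s ∷ rest) (n mod suc (length rest)) ≡ lit b → t (n + q * suc (length rest)) ≡ t n
letter-periodic s rest limit n q P[n]≡b =
  trans (letter-fixed s rest limit (n + q * L) (trans (cong (lookup (s ∷ rest)) (mod-periodic n q L)) P[n]≡b))
        (sym (letter-fixed s rest limit n P[n]≡b))
  where
    L : ℕ
    L = suc (length rest)

last-letter⇒constant-on-multiples : ∀ {k} s (rest : List (Sym k)) {t b} → IsLimit (Tseq s rest) t →
  lookup (s ∷ rest) (fromℕ (length rest)) ≡ lit b →
  ∀ n → t at (suc n * suc (length rest)) ≡ t at suc (length rest)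
last-letter⇒constant-on-multiples s rest limit last≡b n =
  letter-periodic s rest limit (length rest) n (trans (cong (lookup (s ∷ rest)) (last-index (length rest))) last≡b)

last-gap⇒periodic : ∀ {k} s (rest : List (Sym k)) {t f} → gapCount (s ∷ rest) ≡ 1 → IsLimit (Tseq s rest) t →
  lookup (s ∷ rest) (fromℕ (length rest)) ≡ gap f → PeriodicOffMultiples (suc (length rest)) (t at_)
last-gap⇒periodic s rest one limit last≡gap zero q L∤0 = contradiction (_ ∣0) L∤0
last-gap⇒periodic s rest one limit last≡gap (suc n) q L∤N
  with letter-off-gap (s ∷ rest) (fromℕ (length rest)) (n mod suc (length rest)) one (cong isGap last≡gap)
                      (L∤N ∘ last-index⇒multiple n (length rest))
... | _ , P[n]≡b = letter-periodic s rest limit n q P[n]≡b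

last-gap⇒two≤length : ∀ {k} a (rest : List (Sym k)) {f} →
  lookup (lit a ∷ rest) (fromℕ (length rest)) ≡ gap f → 2 ≤ suc (length rest)
last-gap⇒two≤length a []      ()
last-gap⇒two≤length a (_ ∷ _) _ = s≤s (s≤s z≤n)

mainTheorem13 : (k : ℕ) (a : Fin (suc k)) (rest : List (Sym k))
    → gapCount (lit a ∷ rest) ≡ 1
    → (t : ℕ → Fin (suc k))
    → IsLimit (Tseq (lit a) rest) t
    → CompletelyAdditive t
    → ¬ IsPrimePower (length (lit a ∷ rest))
    → ∀ n → t n ≡ Fin.zero
mainTheorem13 k a rest one-gap t limit additive not-prime-power
  with lookup (lit a ∷ rest) (fromℕ (length rest)) in last
... | lit _ = vanish-of-constant-on-multiples t additive (suc (length rest))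
                (last-letter⇒constant-on-multiples (lit a) rest limit last)
... | gap _ = vanish-everywhere t additive (last-gap⇒periodic (lit a) rest one-gap limit last) 2≤L
                (non-prime-power-split (suc (length rest)) 2≤L not-prime-power)
  where
    2≤L : 2 ≤ suc (length rest)
    2≤L = last-gap⇒two≤length a rest last
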